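{- Let $v\neq 18$. There exists a $3$-way $5$-homogeneous $(v,3,2)$ Steiner trade if and only if $v\ge 12$ and $v\equiv 0\pmod 3$.
   Context: Let $V$ be a finite set with $v$ elements and let $t<k<v$ be positive integers. A $\mu$-way $(v,k,t)$ trade $T=\{T_1,\dots,T_\mu\}$ of volume $m$ consists of $\mu$ pairwise disjoint collections $T_1,\dots,T_\mu$, each of $m$ blocks ($k$-subsets of $V$), such that every $t$-subset of $V$ is contained in the same number of blocks in each $T_i$. The foundation $\mathrm{found}(T)$ is the set of elements covered by the blocks. It is a Steiner trade if every $t$-subset of $\mathrm{found}(T)$ is in at most one block of each $T_i$, and $d$-homogeneous if every element of $V$ lies in exactly $d$ blocks of each $T_i$. -}

module Defs where

open import Data.Nat using (ℕ; _≤_; _<_)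
open import Data.Fin using (Fin)
open import Data.Fin.Subset as S using (Subset; ∣_∣; _⊆_)
open import Data.Fin.Subset.Properties using (_⊆?_; _∈?_)
open import Data.List using (List; length; filter)
open import Data.List.Membership.Propositional as L using ()
open import Data.List.Relation.Unary.Unique.Propositional using (Unique)
open import Data.Product using (Σ; ∃; _×_)
open import Relation.Binary.PropositionalEquality using (_≡_; _≢_)
open import Relation.Nullary using (¬_)

count : ∀ {v} → Subset v → List (Subset v) → ℕ
count X B = length (filter (λ b → X ⊆? b) B)

degree : ∀ {v} → Fin v → List (Subset v) → ℕ
degree x B = length (filter (λ b → x ∈? b) B)

-- A μ-way (v,k,t) trade of volume m (with t < k < v).
record Trade (μ v k t m : ℕ) : Set where
  field
    t<k      : t < k
    k<v      : k < v
    blocks   : Fin μ → List (Subset v)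
    distinct : ∀ i → Unique (blocks i)
    volume   : ∀ i → length (blocks i) ≡ m
    blockSize : ∀ i b → b L.∈ blocks i → ∣ b ∣ ≡ k
    disjoint : ∀ i j → i ≢ j → ∀ b → b L.∈ blocks i → ¬ (b L.∈ blocks j)
    balanced : ∀ (X : Subset v) → ∣ X ∣ ≡ t → ∀ i j → count X (blocks i) ≡ count X (blocks j)

open Trade public

_∈found_ : ∀ {μ v k t m} → Fin v → Trade μ v k t m → Set
x ∈found T = ∃ λ i → ∃ λ b → b L.∈ blocks T i × x S.∈ b

found⊆ : ∀ {μ v k t m} → Subset v → Trade μ v k t m → Set
found⊆ X T = ∀ x → x S.∈ X → x ∈found T

Steiner : ∀ {μ v k t m} → Trade μ v k t m → Set
Steiner {t = t} T = ∀ X → ∣ X ∣ ≡ t → found⊆ X T → ∀ i → count X (blocks T i) ≤ 1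

Homogeneous : ∀ {μ v k t m} → ℕ → Trade μ v k t m → Set
Homogeneous d T = ∀ x i → degree x (blocks T i) ≡ d

-- Necessity is double counting inside one collection T_i. Counting point-block incidences gives
-- 5v = 3m, so 3 divides v. The blocks through a fixed point x carry 3 * 5 = 15 incidences: 5 at x
-- itself and, by the Steiner property, at most one at every other point; hence v - 1 ≥ 10, and
-- v ≥ 12 since 3 divides v. Sufficiency: trades on 12, 15 and 21 points are exhibited and checked
-- by computation, and the disjoint union of two homogeneous Steiner trades is again one; every
-- admissible v other than 18 is a sum of the orders 12, 15 and 21.

module Submission where

open import Defs
open import Algebra.Properties.CommutativeMonoid.Sum as Sum using ()
open import Data.Bool using (true; false; _∨_)
import Data.Bool.Properties as Bool
open import Data.Empty using (⊥-elim)
open import Data.Fin as Fin using (Fin; zero; suc; toℕ; _↑ˡ_; _↑ʳ_; splitAt)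
open import Data.Fin.Properties using (all?; join-splitAt)
open import Data.Fin.Subset using (Subset; inside; outside; ∣_∣; _∈_; _⊆_; ⊥; ⁅_⁆; _∪_; Nonempty)
open import Data.Fin.Subset.Properties
  using (_⊆?_; _∈?_; drop-∷-⊆; ⊆-refl; ∉⊥; ∣⊥∣≡0; Empty-unique; nonempty?; x∈⁅x⁆; x∈⁅y⁆⇒x≡y;
         ∣⁅x⁆∣≡1; p⊆p∪q; q⊆p∪q; x∈p∪q⁻; ∪-identityˡ; ∪-identityʳ)
open import Data.List as List using (List; []; _∷_; length; map; filter)
open import Data.List.Membership.Propositional using () renaming (_∈_ to _∈ₗ_; _∉_ to _∉ₗ_)
open import Data.List.Membership.Propositional.Properties
  using (∈-++⁺ˡ; ∈-++⁺ʳ; ∈-++⁻; ∈-map⁺; ∈-map⁻; ∈-filter⁻)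
open import Data.List.Properties using (length-++; length-map; filter-++; filter-≐; filter-none; filter-idem)
open import Data.List.Relation.Unary.All as All using (All)
open import Data.List.Relation.Unary.Any as Any using ()
open import Data.List.Relation.Unary.Unique.Propositional using (Unique)
import Data.List.Relation.Unary.Unique.Propositional.Properties as Unique
open import Data.Nat
  using (ℕ; zero; suc; _+_; _*_; _≤_; _<_; _%_; z≤n; s≤s; _≡ᵇ_; _≟_; _≤?_; _<?_)
open import Data.Nat.Coprimality using (coprime?; coprime-divisor)
open import Data.Nat.Divisibility using (_∣_; divides; n∣m⇒m%n≡0; m%n≡0⇒n∣m)
open import Data.Nat.Properties
open import Data.Product using (∃; Σ; _×_; _,_; proj₁; proj₂)
open import Data.Sum using (_⊎_; inj₁; inj₂)
open import Data.Vec as Vec using ([]; _∷_; _++_; tabulate; here; there)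
open import Data.Vec.Properties using (≡-dec; ++-injectiveˡ; ++-injectiveʳ)
open import Function using (_∘_; _⇔_; mk⇔)
open import Relation.Binary.PropositionalEquality
open import Relation.Nullary using (Dec; does; yes; no; ¬_; ¬?; contradiction)
open import Relation.Nullary.Decidable using (_×-dec_; _→-dec_; toWitness)
open import Relation.Unary using (Pred; Decidable; _≐_)
import Data.List.Membership.DecPropositional as DecMembership
import Data.List.Relation.Unary.Unique.DecPropositional as DecUnique

open Sum +-0-commutativeMonoid using (sum; sum-syntax; sum-cong-≗; ∑-distrib-+; sum-replicate-zero)

module _ {a p} {A : Set a} {P : Pred A p} (P? : Decidable P) where

  length-filter-++ : ∀ xs ys →
    length (filter P? (xs List.++ ys)) ≡ length (filter P? xs) + length (filter P? ys)
  length-filter-++ xs ys = trans (cong length (filter-++ P? xs ys)) (length-++ (filter P? xs))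

  length-filter-none : ∀ {xs} → All (¬_ ∘ P) xs → length (filter P? xs) ≡ 0
  length-filter-none none = cong length (filter-none P? none)

  length-filter-map : ∀ {b} {B : Set b} (f : B → A) xs →
    length (filter P? (map f xs)) ≡ length (filter (P? ∘ f) xs)
  length-filter-map f [] = refl
  length-filter-map f (x ∷ xs) with does (P? (f x))
  ... | true  = cong suc (length-filter-map f xs)
  ... | false = length-filter-map f xs

  ∃-∈-filter : ∀ xs {n} → length (filter P? xs) ≡ suc n → ∃ λ x → x ∈ₗ xs × P x
  ∃-∈-filter xs len≡ with filter P? xs in filter≡
  ... | y ∷ _ = y , ∈-filter⁻ P? (subst (y ∈ₗ_) (sym filter≡) (Any.here refl))

length-filter-≐ : ∀ {a p q} {A : Set a} {P : Pred A p} {Q : Pred A q}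
  (P? : Decidable P) (Q? : Decidable Q) → P ≐ Q → ∀ xs → length (filter P? xs) ≡ length (filter Q? xs)
length-filter-≐ P? Q? P≐Q xs = cong length (filter-≐ P? Q? P≐Q xs)

pair⊆⁺ : ∀ {n} {x y : Fin n} {b} → x ∈ b → y ∈ b → ⁅ x ⁆ ∪ ⁅ y ⁆ ⊆ b
pair⊆⁺ {x = x} {y} {b} x∈b y∈b z∈ with x∈p∪q⁻ ⁅ x ⁆ ⁅ y ⁆ z∈
... | inj₁ z∈⁅x⁆ = subst (_∈ b) (sym (x∈⁅y⁆⇒x≡y x z∈⁅x⁆)) x∈b
... | inj₂ z∈⁅y⁆ = subst (_∈ b) (sym (x∈⁅y⁆⇒x≡y y z∈⁅y⁆)) y∈b

pair⊆⁻ : ∀ {n} {x y : Fin n} {b} → ⁅ x ⁆ ∪ ⁅ y ⁆ ⊆ b → x ∈ b × y ∈ b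
pair⊆⁻ {x = x} {y} pair⊆b = pair⊆b (p⊆p∪q ⁅ y ⁆ (x∈⁅x⁆ x)) , pair⊆b (q⊆p∪q ⁅ x ⁆ ⁅ y ⁆ (x∈⁅x⁆ y))

∣⁅x⁆∪⁅y⁆∣≡2 : ∀ {n} {x y : Fin n} → x ≢ y → ∣ ⁅ x ⁆ ∪ ⁅ y ⁆ ∣ ≡ 2
∣⁅x⁆∪⁅y⁆∣≡2 {x = zero}  {zero}  x≢y = contradiction refl x≢y
∣⁅x⁆∪⁅y⁆∣≡2 {x = zero}  {suc y} x≢y = cong suc (trans (cong ∣_∣ (∪-identityˡ ⁅ y ⁆)) (∣⁅x⁆∣≡1 y))
∣⁅x⁆∪⁅y⁆∣≡2 {x = suc x} {zero}  x≢y = cong suc (trans (cong ∣_∣ (∪-identityʳ ⁅ x ⁆)) (∣⁅x⁆∣≡1 x))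
∣⁅x⁆∪⁅y⁆∣≡2 {x = suc x} {suc y} x≢y = ∣⁅x⁆∪⁅y⁆∣≡2 (x≢y ∘ cong suc)

∣p++q∣≡∣p∣+∣q∣ : ∀ {m n} (p : Subset m) (q : Subset n) → ∣ p ++ q ∣ ≡ ∣ p ∣ + ∣ q ∣
∣p++q∣≡∣p∣+∣q∣ []            q = refl
∣p++q∣≡∣p∣+∣q∣ (inside  ∷ p) q = cong suc (∣p++q∣≡∣p∣+∣q∣ p q)
∣p++q∣≡∣p∣+∣q∣ (outside ∷ p) q = ∣p++q∣≡∣p∣+∣q∣ p q

x∈p⇒x↑ˡn∈p++q : ∀ {m n} {p : Subset m} {q : Subset n} {x} → x ∈ p → x ↑ˡ n ∈ p ++ q
x∈p⇒x↑ˡn∈p++q here        = here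
x∈p⇒x↑ˡn∈p++q (there x∈p) = there (x∈p⇒x↑ˡn∈p++q x∈p)

x↑ˡn∈p++q⇒x∈p : ∀ {m n} {p : Subset m} {q : Subset n} x → x ↑ˡ n ∈ p ++ q → x ∈ p
x↑ˡn∈p++q⇒x∈p {p = _ ∷ _} zero    here      = here
x↑ˡn∈p++q⇒x∈p {p = _ ∷ _} (suc x) (there x∈) = there (x↑ˡn∈p++q⇒x∈p x x∈)

y∈q⇒m↑ʳy∈p++q : ∀ {m n} (p : Subset m) {q : Subset n} {y} → y ∈ q → m ↑ʳ y ∈ p ++ q
y∈q⇒m↑ʳy∈p++q []      y∈q = y∈q
y∈q⇒m↑ʳy∈p++q (_ ∷ p) y∈q = there (y∈q⇒m↑ʳy∈p++q p y∈q)

m↑ʳy∈p++q⇒y∈q : ∀ {m n} (p : Subset m) {q : Subset n} {y} → m ↑ʳ y ∈ p ++ q → y ∈ q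
m↑ʳy∈p++q⇒y∈q []      y∈ = y∈
m↑ʳy∈p++q⇒y∈q (_ ∷ p) (there y∈) = m↑ʳy∈p++q⇒y∈q p y∈

++-⊆⁺ : ∀ {m n} {p r : Subset m} {q s : Subset n} → p ⊆ r → q ⊆ s → p ++ q ⊆ r ++ s
++-⊆⁺ {p = []}    {[]}    _   q⊆s = q⊆s
++-⊆⁺ {p = _ ∷ _} {_ ∷ _} p⊆r q⊆s here       = x∈p⇒x↑ˡn∈p++q (p⊆r here)
++-⊆⁺ {p = _ ∷ _} {_ ∷ _} p⊆r q⊆s (there x∈) = there (++-⊆⁺ (drop-∷-⊆ p⊆r) q⊆s x∈)

++-⊆⁻ : ∀ {m n} {p r : Subset m} {q s : Subset n} → p ++ q ⊆ r ++ s → p ⊆ r × q ⊆ s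
++-⊆⁻ {p = p} {r} pq⊆rs =
  (λ {x} x∈p → x↑ˡn∈p++q⇒x∈p x (pq⊆rs (x∈p⇒x↑ˡn∈p++q x∈p))) ,
  (λ y∈q → m↑ʳy∈p++q⇒y∈q r (pq⊆rs (y∈q⇒m↑ʳy∈p++q p y∈q)))

liftˡ : ∀ {m} n → Subset m → Subset (m + n)
liftˡ n p = p ++ ⊥

liftʳ : ∀ m {n} → Subset n → Subset (m + n)
liftʳ m q = ⊥ ++ q

liftˡ-injective : ∀ {m} n {p p′ : Subset m} → liftˡ n p ≡ liftˡ n p′ → p ≡ p′
liftˡ-injective n {p} {p′} = ++-injectiveˡ p p′

liftʳ-injective : ∀ m {n} {q q′ : Subset n} → liftʳ m q ≡ liftʳ m q′ → q ≡ q′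
liftʳ-injective m = ++-injectiveʳ ⊥ ⊥

∣liftˡ∣ : ∀ {m} n (p : Subset m) → ∣ liftˡ n p ∣ ≡ ∣ p ∣
∣liftˡ∣ n p = trans (∣p++q∣≡∣p∣+∣q∣ p ⊥) (trans (cong (∣ p ∣ +_) (∣⊥∣≡0 n)) (+-identityʳ ∣ p ∣))

∣liftʳ∣ : ∀ m {n} (q : Subset n) → ∣ liftʳ m q ∣ ≡ ∣ q ∣
∣liftʳ∣ m q = trans (∣p++q∣≡∣p∣+∣q∣ (⊥ {m}) q) (cong (_+ ∣ q ∣) (∣⊥∣≡0 m))

liftˡ≢liftʳ : ∀ {m n} {p : Subset m} {q : Subset n} → ∣ p ∣ ≢ 0 → liftˡ n p ≢ liftʳ m q
liftˡ≢liftʳ {m} {p = p} ∣p∣≢0 eq = ∣p∣≢0 (trans (cong ∣_∣ (++-injectiveˡ p ⊥ eq)) (∣⊥∣≡0 m))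

module _ {m n : ℕ} where

  count-liftˡ : ∀ (X : Subset m) B → count (liftˡ n X) (map (liftˡ n) B) ≡ count X B
  count-liftˡ X B = trans (length-filter-map (liftˡ n X ⊆?_) (liftˡ n) B)
    (length-filter-≐ (λ b → liftˡ n X ⊆? liftˡ n b) (X ⊆?_)
      ((λ X⊆b → proj₁ (++-⊆⁻ {m} {n} X⊆b)) , (λ X⊆b → ++-⊆⁺ {m} {n} X⊆b ⊆-refl)) B)

  count-liftʳ : ∀ (Y : Subset n) B → count (liftʳ m Y) (map (liftʳ m) B) ≡ count Y B
  count-liftʳ Y B = trans (length-filter-map (liftʳ m Y ⊆?_) (liftʳ m) B)
    (length-filter-≐ (λ b → liftʳ m Y ⊆? liftʳ m b) (Y ⊆?_)
      ((λ Y⊆b → proj₂ (++-⊆⁻ {m} {n} Y⊆b)) , (λ Y⊆b → ++-⊆⁺ {m} {n} ⊆-refl Y⊆b)) B)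

  count-liftˡ-straddling : ∀ X {Y : Subset n} → Nonempty Y → ∀ B → count (X ++ Y) (map (liftˡ n) B) ≡ 0
  count-liftˡ-straddling X {Y} (y , y∈Y) B = trans (length-filter-map ((X ++ Y) ⊆?_) (liftˡ n) B)
    (length-filter-none (λ b → X ++ Y ⊆? liftˡ n b)
      (All.universal (λ b (XY⊆ : X ++ Y ⊆ liftˡ n b) → ∉⊥ (proj₂ (++-⊆⁻ {m} {n} XY⊆) y∈Y)) B))

  count-liftʳ-straddling : ∀ {X : Subset m} Y → Nonempty X → ∀ B → count (X ++ Y) (map (liftʳ m) B) ≡ 0
  count-liftʳ-straddling {X} Y (x , x∈X) B = trans (length-filter-map ((X ++ Y) ⊆?_) (liftʳ m) B)
    (length-filter-none (λ b → X ++ Y ⊆? liftʳ m b)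
      (All.universal (λ b (XY⊆ : X ++ Y ⊆ liftʳ m b) → ∉⊥ (proj₁ (++-⊆⁻ {m} {n} XY⊆) x∈X)) B))

  degree-↑ˡ-liftˡ : ∀ (x : Fin m) B → degree (x ↑ˡ n) (map (liftˡ n) B) ≡ degree x B
  degree-↑ˡ-liftˡ x B = trans (length-filter-map ((x ↑ˡ n) ∈?_) (liftˡ n) B)
    (length-filter-≐ (λ b → x ↑ˡ n ∈? liftˡ n b) (x ∈?_) (x↑ˡn∈p++q⇒x∈p x , x∈p⇒x↑ˡn∈p++q) B)

  degree-↑ʳ-liftʳ : ∀ (y : Fin n) B → degree (m ↑ʳ y) (map (liftʳ m) B) ≡ degree y B
  degree-↑ʳ-liftʳ y B = trans (length-filter-map ((m ↑ʳ y) ∈?_) (liftʳ m) B)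
    (length-filter-≐ (λ b → m ↑ʳ y ∈? liftʳ m b) (y ∈?_) (m↑ʳy∈p++q⇒y∈q ⊥ , y∈q⇒m↑ʳy∈p++q ⊥) B)

  degree-↑ˡ-liftʳ : ∀ (x : Fin m) B → degree (x ↑ˡ n) (map (liftʳ m) B) ≡ 0
  degree-↑ˡ-liftʳ x B = trans (length-filter-map ((x ↑ˡ n) ∈?_) (liftʳ m) B)
    (length-filter-none (λ b → x ↑ˡ n ∈? liftʳ m b)
      (All.universal (λ b (x∈ : x ↑ˡ n ∈ liftʳ m b) → ∉⊥ (x↑ˡn∈p++q⇒x∈p x x∈)) B))

  degree-↑ʳ-liftˡ : ∀ (y : Fin n) B → degree (m ↑ʳ y) (map (liftˡ n) B) ≡ 0
  degree-↑ʳ-liftˡ y B = trans (length-filter-map ((m ↑ʳ y) ∈?_) (liftˡ n) B)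
    (length-filter-none (λ b → m ↑ʳ y ∈? liftˡ n b)
      (All.universal (λ b (y∈ : m ↑ʳ y ∈ liftˡ n b) → ∉⊥ (m↑ʳy∈p++q⇒y∈q b y∈)) B))


-- The Steiner condition on every t-subset of V, not only on those inside found(T): this is the form
-- preserved by disjoint unions, and it agrees with Steiner for homogeneous trades.
FullySteiner : ∀ {μ v k t m} → Trade μ v k t m → Set
FullySteiner {t = t} T = ∀ X → ∣ X ∣ ≡ t → ∀ i → count X (blocks T i) ≤ 1

record HomogeneousSteinerTrade (μ v k t d : ℕ) : Set where
  field
    {volume}    : ℕ
    trade       : Trade μ v k t volume
    steiner     : FullySteiner trade
    homogeneous : Homogeneous d trade

open HomogeneousSteinerTrade using (trade; steiner; homogeneous)

homogeneous⇒covered : ∀ {μ v k t m d} (T : Trade μ v k t m) → Homogeneous (suc d) T →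
  Fin μ → ∀ x → x ∈found T
homogeneous⇒covered T H i x = i , ∃-∈-filter (x ∈?_) (blocks T i) (H x i)

steiner⇒fullySteiner : ∀ {μ v k t m d} (T : Trade μ v k t m) → Homogeneous (suc d) T →
  Steiner T → FullySteiner T
steiner⇒fullySteiner T H S X ∣X∣≡t i = S X ∣X∣≡t (λ x _ → homogeneous⇒covered T H i x) i

fullySteiner⇒steiner : ∀ {μ v k t m} (T : Trade μ v k t m) → FullySteiner T → Steiner T
fullySteiner⇒steiner T S X ∣X∣≡t _ = S X ∣X∣≡t

-- Disjoint unions

∣block∣≢0 : ∀ {μ v k t m} (T : Trade μ v k t m) i {b} → b ∈ₗ blocks T i → ∣ b ∣ ≢ 0
∣block∣≢0 T i {b} b∈ ∣b∣≡0 = n≮0 (subst (_ <_) (trans (sym (blockSize T i b b∈)) ∣b∣≡0) (t<k T))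

module _ {μ v₁ v₂ k t m₁ m₂} (T₁ : Trade μ v₁ k t m₁) (T₂ : Trade μ v₂ k t m₂) where

  private
    B₁ = blocks T₁
    B₂ = blocks T₂

  unionBlocks : Fin μ → List (Subset (v₁ + v₂))
  unionBlocks i = map (liftˡ v₂) (B₁ i) List.++ map (liftʳ v₁) (B₂ i)

  ∈-unionBlocks⁻ : ∀ i {b} → b ∈ₗ unionBlocks i →
    (∃ λ c → c ∈ₗ B₁ i × b ≡ liftˡ v₂ c) ⊎ (∃ λ d → d ∈ₗ B₂ i × b ≡ liftʳ v₁ d)
  ∈-unionBlocks⁻ i b∈ with ∈-++⁻ (map (liftˡ v₂) (B₁ i)) b∈
  ... | inj₁ b∈ˡ = inj₁ (∈-map⁻ (liftˡ v₂) b∈ˡ)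
  ... | inj₂ b∈ʳ = inj₂ (∈-map⁻ (liftʳ v₁) b∈ʳ)

  count-unionBlocks : ∀ X i →
    count X (unionBlocks i) ≡ count X (map (liftˡ v₂) (B₁ i)) + count X (map (liftʳ v₁) (B₂ i))
  count-unionBlocks X i = length-filter-++ (X ⊆?_) (map (liftˡ v₂) (B₁ i)) _

  degree-unionBlocks : ∀ x i →
    degree x (unionBlocks i) ≡ degree x (map (liftˡ v₂) (B₁ i)) + degree x (map (liftʳ v₁) (B₂ i))
  degree-unionBlocks x i = length-filter-++ (x ∈?_) (map (liftˡ v₂) (B₁ i)) _

  unique-unionBlocks : ∀ i → Unique (unionBlocks i)
  unique-unionBlocks i = Unique.++⁺ (Unique.map⁺ (liftˡ-injective v₂) (distinct T₁ i))
    (Unique.map⁺ (liftʳ-injective v₁) (distinct T₂ i)) λ (b∈ˡ , b∈ʳ) → apart (∈-map⁻ _ b∈ˡ) (∈-map⁻ _ b∈ʳ)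
    where
    apart : ∀ {b} → (∃ λ c → c ∈ₗ B₁ i × b ≡ liftˡ v₂ c) → (∃ λ d → d ∈ₗ B₂ i × b ≡ liftʳ v₁ d) → _
    apart (c , c∈ , refl) (d , _ , c≡d) = liftˡ≢liftʳ {p = c} (∣block∣≢0 T₁ i c∈) c≡d

  disjoint-unionBlocks : ∀ i j → i ≢ j → ∀ b → b ∈ₗ unionBlocks i → b ∉ₗ unionBlocks j
  disjoint-unionBlocks i j i≢j b b∈i b∈j with ∈-unionBlocks⁻ i b∈i | ∈-unionBlocks⁻ j b∈j
  ... | inj₁ (c , c∈ , refl) | inj₁ (c′ , c′∈ , c≡c′) =
    disjoint T₁ i j i≢j c c∈ (subst (_∈ₗ B₁ j) (sym (liftˡ-injective v₂ c≡c′)) c′∈)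
  ... | inj₁ (c , c∈ , refl) | inj₂ (d , _ , c≡d) = liftˡ≢liftʳ {p = c} (∣block∣≢0 T₁ i c∈) c≡d
  ... | inj₂ (d , _ , refl) | inj₁ (c , c∈ , d≡c) = liftˡ≢liftʳ {p = c} (∣block∣≢0 T₁ j c∈) (sym d≡c)
  ... | inj₂ (d , d∈ , refl) | inj₂ (d′ , d′∈ , d≡d′) =
    disjoint T₂ i j i≢j d d∈ (subst (_∈ₗ B₂ j) (sym (liftʳ-injective v₁ d≡d′)) d′∈)

  blockSize-unionBlocks : ∀ i b → b ∈ₗ unionBlocks i → ∣ b ∣ ≡ k
  blockSize-unionBlocks i b b∈ with ∈-unionBlocks⁻ i b∈
  ... | inj₁ (c , c∈ , refl) = trans (∣liftˡ∣ v₂ c) (blockSize T₁ i c c∈)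
  ... | inj₂ (d , d∈ , refl) = trans (∣liftʳ∣ v₁ d) (blockSize T₂ i d d∈)

  balanced-liftˡ : ∀ X₁ X₂ → ∣ X₁ ++ X₂ ∣ ≡ t → ∀ i j →
    count (X₁ ++ X₂) (map (liftˡ v₂) (B₁ i)) ≡ count (X₁ ++ X₂) (map (liftˡ v₂) (B₁ j))
  balanced-liftˡ X₁ X₂ ∣X∣≡t i j with nonempty? X₂
  ... | yes X₂≢∅ = trans (count-liftˡ-straddling X₁ X₂≢∅ (B₁ i)) (sym (count-liftˡ-straddling X₁ X₂≢∅ (B₁ j)))
  ... | no X₂-empty with refl ← Empty-unique X₂-empty = begin
    count (liftˡ v₂ X₁) (map (liftˡ v₂) (B₁ i)) ≡⟨ count-liftˡ X₁ (B₁ i) ⟩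
    count X₁ (B₁ i)                              ≡⟨ balanced T₁ X₁ (trans (sym (∣liftˡ∣ v₂ X₁)) ∣X∣≡t) i j ⟩
    count X₁ (B₁ j)                              ≡⟨ count-liftˡ X₁ (B₁ j) ⟨
    count (liftˡ v₂ X₁) (map (liftˡ v₂) (B₁ j)) ∎
    where open ≡-Reasoning

  balanced-liftʳ : ∀ X₁ X₂ → ∣ X₁ ++ X₂ ∣ ≡ t → ∀ i j →
    count (X₁ ++ X₂) (map (liftʳ v₁) (B₂ i)) ≡ count (X₁ ++ X₂) (map (liftʳ v₁) (B₂ j))
  balanced-liftʳ X₁ X₂ ∣X∣≡t i j with nonempty? X₁
  ... | yes X₁≢∅ = trans (count-liftʳ-straddling X₂ X₁≢∅ (B₂ i)) (sym (count-liftʳ-straddling X₂ X₁≢∅ (B₂ j)))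
  ... | no X₁-empty with refl ← Empty-unique X₁-empty = begin
    count (liftʳ v₁ X₂) (map (liftʳ v₁) (B₂ i)) ≡⟨ count-liftʳ X₂ (B₂ i) ⟩
    count X₂ (B₂ i)                              ≡⟨ balanced T₂ X₂ (trans (sym (∣liftʳ∣ v₁ X₂)) ∣X∣≡t) i j ⟩
    count X₂ (B₂ j)                              ≡⟨ count-liftʳ X₂ (B₂ j) ⟨
    count (liftʳ v₁ X₂) (map (liftʳ v₁) (B₂ j)) ∎
    where open ≡-Reasoning

  balanced-unionBlocks : ∀ X → ∣ X ∣ ≡ t → ∀ i j → count X (unionBlocks i) ≡ count X (unionBlocks j)
  balanced-unionBlocks X ∣X∣≡t i j with Vec.splitAt v₁ X
  ... | X₁ , X₂ , refl = begin
    count (X₁ ++ X₂) (unionBlocks i)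
      ≡⟨ count-unionBlocks (X₁ ++ X₂) i ⟩
    count (X₁ ++ X₂) (map (liftˡ v₂) (B₁ i)) + count (X₁ ++ X₂) (map (liftʳ v₁) (B₂ i))
      ≡⟨ cong₂ _+_ (balanced-liftˡ X₁ X₂ ∣X∣≡t i j) (balanced-liftʳ X₁ X₂ ∣X∣≡t i j) ⟩
    count (X₁ ++ X₂) (map (liftˡ v₂) (B₁ j)) + count (X₁ ++ X₂) (map (liftʳ v₁) (B₂ j))
      ≡⟨ count-unionBlocks (X₁ ++ X₂) j ⟨
    count (X₁ ++ X₂) (unionBlocks j) ∎
    where open ≡-Reasoning

  disjointUnion : Trade μ (v₁ + v₂) k t (m₁ + m₂)
  disjointUnion = record
    { t<k       = t<k T₁
    ; k<v       = <-≤-trans (k<v T₁) (m≤m+n v₁ v₂)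
    ; blocks    = unionBlocks
    ; distinct  = unique-unionBlocks
    ; volume    = λ i → trans (length-++ (map (liftˡ v₂) (B₁ i)))
                    (cong₂ _+_ (trans (length-map _ (B₁ i)) (volume T₁ i))
                               (trans (length-map _ (B₂ i)) (volume T₂ i)))
    ; blockSize = blockSize-unionBlocks
    ; disjoint  = disjoint-unionBlocks
    ; balanced  = balanced-unionBlocks
    }

  homogeneous-disjointUnion : ∀ {d} → Homogeneous d T₁ → Homogeneous d T₂ → Homogeneous d disjointUnion
  homogeneous-disjointUnion {d} H₁ H₂ x i with splitAt v₁ x | join-splitAt v₁ v₂ x
  ... | inj₁ x₁ | refl = begin
    degree (x₁ ↑ˡ v₂) (unionBlocks i)                  ≡⟨ degree-unionBlocks (x₁ ↑ˡ v₂) i ⟩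
    degree (x₁ ↑ˡ v₂) (map (liftˡ v₂) (B₁ i)) + degree (x₁ ↑ˡ v₂) (map (liftʳ v₁) (B₂ i))
                                                        ≡⟨ cong₂ _+_ (degree-↑ˡ-liftˡ x₁ (B₁ i)) (degree-↑ˡ-liftʳ x₁ (B₂ i)) ⟩
    degree x₁ (B₁ i) + 0                                ≡⟨ +-identityʳ _ ⟩
    degree x₁ (B₁ i)                                    ≡⟨ H₁ x₁ i ⟩
    d ∎
    where open ≡-Reasoning
  ... | inj₂ x₂ | refl = begin
    degree (v₁ ↑ʳ x₂) (unionBlocks i)                  ≡⟨ degree-unionBlocks (v₁ ↑ʳ x₂) i ⟩
    degree (v₁ ↑ʳ x₂) (map (liftˡ v₂) (B₁ i)) + degree (v₁ ↑ʳ x₂) (map (liftʳ v₁) (B₂ i))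
                                                        ≡⟨ cong₂ _+_ (degree-↑ʳ-liftˡ x₂ (B₁ i)) (degree-↑ʳ-liftʳ x₂ (B₂ i)) ⟩
    0 + degree x₂ (B₂ i)                                ≡⟨ H₂ x₂ i ⟩
    d ∎
    where open ≡-Reasoning

fullySteiner-disjointUnion : ∀ {μ v₁ v₂ k t m₁ m₂}
  (T₁ : Trade μ v₁ k (suc t) m₁) (T₂ : Trade μ v₂ k (suc t) m₂) →
  FullySteiner T₁ → FullySteiner T₂ → FullySteiner (disjointUnion T₁ T₂)
fullySteiner-disjointUnion {v₁ = v₁} {v₂} T₁ T₂ S₁ S₂ X ∣X∣≡1+t i with Vec.splitAt v₁ X
... | X₁ , X₂ , refl with nonempty? X₁ | nonempty? X₂
... | yes X₁≢∅ | yes X₂≢∅ = begin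
  count (X₁ ++ X₂) (unionBlocks T₁ T₂ i)
    ≡⟨ count-unionBlocks T₁ T₂ (X₁ ++ X₂) i ⟩
  count (X₁ ++ X₂) (map (liftˡ v₂) (blocks T₁ i)) + count (X₁ ++ X₂) (map (liftʳ v₁) (blocks T₂ i))
    ≡⟨ cong₂ _+_ (count-liftˡ-straddling X₁ X₂≢∅ (blocks T₁ i)) (count-liftʳ-straddling X₂ X₁≢∅ (blocks T₂ i)) ⟩
  0 ≤⟨ z≤n ⟩
  1 ∎
  where open ≤-Reasoning
... | yes X₁≢∅ | no X₂-empty with refl ← Empty-unique X₂-empty = begin
  count (liftˡ v₂ X₁) (unionBlocks T₁ T₂ i)
    ≡⟨ count-unionBlocks T₁ T₂ (liftˡ v₂ X₁) i ⟩
  count (liftˡ v₂ X₁) (map (liftˡ v₂) (blocks T₁ i)) + count (liftˡ v₂ X₁) (map (liftʳ v₁) (blocks T₂ i))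
    ≡⟨ cong₂ _+_ (count-liftˡ X₁ (blocks T₁ i)) (count-liftʳ-straddling ⊥ X₁≢∅ (blocks T₂ i)) ⟩
  count X₁ (blocks T₁ i) + 0
    ≡⟨ +-identityʳ _ ⟩
  count X₁ (blocks T₁ i)
    ≤⟨ S₁ X₁ (trans (sym (∣liftˡ∣ v₂ X₁)) ∣X∣≡1+t) i ⟩
  1 ∎
  where open ≤-Reasoning
... | no X₁-empty | yes X₂≢∅ with refl ← Empty-unique X₁-empty = begin
  count (liftʳ v₁ X₂) (unionBlocks T₁ T₂ i)
    ≡⟨ count-unionBlocks T₁ T₂ (liftʳ v₁ X₂) i ⟩
  count (liftʳ v₁ X₂) (map (liftˡ v₂) (blocks T₁ i)) + count (liftʳ v₁ X₂) (map (liftʳ v₁) (blocks T₂ i))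
    ≡⟨ cong₂ _+_ (count-liftˡ-straddling ⊥ X₂≢∅ (blocks T₁ i)) (count-liftʳ X₂ (blocks T₂ i)) ⟩
  count X₂ (blocks T₂ i)
    ≤⟨ S₂ X₂ (trans (sym (∣liftʳ∣ v₁ X₂)) ∣X∣≡1+t) i ⟩
  1 ∎
  where open ≤-Reasoning
... | no X₁-empty | no X₂-empty with refl ← Empty-unique X₁-empty | refl ← Empty-unique X₂-empty =
  contradiction (trans (sym ∣X∣≡1+t) (trans (∣liftˡ∣ v₂ (⊥ {v₁})) (∣⊥∣≡0 v₁))) λ ()

_⊕_ : ∀ {μ v₁ v₂ k t d} → HomogeneousSteinerTrade μ v₁ k (suc t) d → HomogeneousSteinerTrade μ v₂ k (suc t) d →
  HomogeneousSteinerTrade μ (v₁ + v₂) k (suc t) d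
H₁ ⊕ H₂ = record
  { trade       = disjointUnion (trade H₁) (trade H₂)
  ; steiner     = fullySteiner-disjointUnion (trade H₁) (trade H₂) (steiner H₁) (steiner H₂)
  ; homogeneous = homogeneous-disjointUnion (trade H₁) (trade H₂) (homogeneous H₁) (homogeneous H₂)
  }

-- Double counting

∑-const : ∀ n c → ∑[ i < n ] c ≡ n * c
∑-const zero    c = refl
∑-const (suc n) c = cong (c +_) (∑-const n c)

∑-≤ : ∀ {n} (f : Fin n → ℕ) {c} → (∀ i → f i ≤ c) → ∑[ i < n ] f i ≤ n * c
∑-≤ {zero}  f f≤c = z≤n
∑-≤ {suc n} f f≤c = +-mono-≤ (f≤c zero) (∑-≤ (f ∘ suc) (f≤c ∘ suc))

degree-suc-singleton : ∀ {n} (x : Fin n) s (b : Subset n) → degree (suc x) ((s ∷ b) ∷ []) ≡ degree x (b ∷ [])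
degree-suc-singleton x s b with does (x ∈? b)
... | true  = refl
... | false = refl

∑-degree-singleton : ∀ {n} (b : Subset n) → ∑[ x < n ] degree x (b ∷ []) ≡ ∣ b ∣
∑-degree-singleton []            = refl
∑-degree-singleton (inside  ∷ b) =
  cong suc (trans (sum-cong-≗ (λ x → degree-suc-singleton x inside b)) (∑-degree-singleton b))
∑-degree-singleton (outside ∷ b) =
  trans (sum-cong-≗ (λ x → degree-suc-singleton x outside b)) (∑-degree-singleton b)

handshake : ∀ {n k} (B : List (Subset n)) → (∀ b → b ∈ₗ B → ∣ b ∣ ≡ k) →
  ∑[ x < n ] degree x B ≡ k * length B
handshake {n} {k} [] _ = trans (sum-replicate-zero n) (sym (*-zeroʳ k))
handshake {n} {k} (b ∷ B) sized = begin
  ∑[ x < n ] degree x (b ∷ B)                          ≡⟨ sum-cong-≗ (λ x → length-filter-++ (x ∈?_) (b ∷ []) B) ⟩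
  ∑[ x < n ] (degree x (b ∷ []) + degree x B)          ≡⟨ ∑-distrib-+ (λ x → degree x (b ∷ [])) (λ x → degree x B) ⟩
  ∑[ x < n ] degree x (b ∷ []) + ∑[ x < n ] degree x B ≡⟨ cong₂ _+_ (trans (∑-degree-singleton b) (sized b (Any.here refl)))
                                                                    (handshake B (λ c c∈ → sized c (Any.there c∈))) ⟩
  k + k * length B                                     ≡⟨ *-suc k (length B) ⟨
  k * length (b ∷ B)                                   ∎
  where open ≡-Reasoning

regular⇒volume : ∀ {n k d} (B : List (Subset n)) → (∀ b → b ∈ₗ B → ∣ b ∣ ≡ k) → (∀ x → degree x B ≡ d) →
  n * d ≡ k * length B
regular⇒volume {n} {d = d} B sized regular =
  trans (sym (∑-const n d)) (trans (sum-cong-≗ (sym ∘ regular)) (handshake B sized))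

degree-blocksThrough : ∀ {n} (x y : Fin n) B → degree y (filter (x ∈?_) B) ≡ count (⁅ x ⁆ ∪ ⁅ y ⁆) B
degree-blocksThrough x y [] = refl
degree-blocksThrough x y (b ∷ B) with ⁅ x ⁆ ∪ ⁅ y ⁆ ⊆? b | x ∈? b
... | yes pair⊆ | no x∉b = contradiction (proj₁ (pair⊆⁻ pair⊆)) x∉b
... | no _      | no _   = degree-blocksThrough x y B
... | yes pair⊆ | yes _ with y ∈? b
...   | yes _   = cong suc (degree-blocksThrough x y B)
...   | no y∉b  = contradiction (proj₂ (pair⊆⁻ pair⊆)) y∉b
degree-blocksThrough x y (b ∷ B) | no ¬pair⊆ | yes x∈b with y ∈? b
...   | yes y∈b = ⊥-elim (¬pair⊆ (pair⊆⁺ x∈b y∈b))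
...   | no _    = degree-blocksThrough x y B

-- The d blocks through point 0 have k d incidences: d at point 0 and at most one at each other point.
regular⇒degreeBound : ∀ {n k d} (B : List (Subset (suc n))) → (∀ b → b ∈ₗ B → ∣ b ∣ ≡ k) →
  (∀ x → degree x B ≡ d) → (∀ x y → x ≢ y → count (⁅ x ⁆ ∪ ⁅ y ⁆) B ≤ 1) → k * d ≤ d + n
regular⇒degreeBound {n} {k} {d} B sized regular pairs = begin
  k * d                                          ≡⟨ cong (k *_) (regular zero) ⟨
  k * length B₀                                  ≡⟨ handshake B₀ (λ b b∈ → sized b (proj₁ (∈-filter⁻ (zero ∈?_) b∈))) ⟨
  degree zero B₀ + ∑[ y < n ] degree (suc y) B₀  ≤⟨ +-mono-≤ (≤-reflexive degree-zero) (∑-≤ _ degree-suc) ⟩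
  d + n * 1                                      ≡⟨ cong (d +_) (*-identityʳ n) ⟩
  d + n                                          ∎
  where
  open ≤-Reasoning
  B₀ = filter (zero ∈?_) B
  degree-zero : degree zero B₀ ≡ d
  degree-zero = trans (cong length (filter-idem (zero ∈?_) B)) (regular zero)
  degree-suc : ∀ y → degree (suc y) B₀ ≤ 1
  degree-suc y = subst (_≤ 1) (sym (degree-blocksThrough zero (suc y) B)) (pairs zero (suc y) λ ())

3∤11 : ¬ 3 ∣ 11
3∤11 3∣11 with n∣m⇒m%n≡0 11 3 3∣11
... | ()

necessary : ∀ {v m} (T : Trade 3 v 3 2 m) → Steiner T → Homogeneous 5 T → 12 ≤ v × 3 ∣ v
necessary {zero} T _ _ = contradiction (k<v T) λ ()
necessary {suc n} T S H = 12≤v , 3∣v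
  where
  B = blocks T zero
  regular = λ x → H x zero
  5v≡3m : suc n * 5 ≡ 3 * length B
  5v≡3m = regular⇒volume B (blockSize T zero) regular
  3∣v : 3 ∣ suc n
  3∣v = coprime-divisor (toWitness {a? = coprime? 3 5} _)
    (divides (length B) (trans (*-comm 5 (suc n)) (trans 5v≡3m (*-comm 3 (length B)))))
  11≤v : 11 ≤ suc n
  11≤v = s≤s (+-cancelˡ-≤ 5 10 n (regular⇒degreeBound B (blockSize T zero) regular
    λ x y x≢y → steiner⇒fullySteiner T H S (⁅ x ⁆ ∪ ⁅ y ⁆) (∣⁅x⁆∪⁅y⁆∣≡2 x≢y) zero))
  12≤v : 12 ≤ suc n
  12≤v with m≤n⇒m<n∨m≡n 11≤v
  ... | inj₁ 11<v = 11<v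
  ... | inj₂ refl = contradiction 3∣v 3∤11

-- Verified constructions

subsetsOfSize : ℕ → (n : ℕ) → List (Subset n)
subsetsOfSize zero    zero    = [] ∷ []
subsetsOfSize (suc k) zero    = []
subsetsOfSize zero    (suc n) = map (outside ∷_) (subsetsOfSize zero n)
subsetsOfSize (suc k) (suc n) =
  map (outside ∷_) (subsetsOfSize (suc k) n) List.++ map (inside ∷_) (subsetsOfSize k n)

∈-subsetsOfSize : ∀ {n} (X : Subset n) → X ∈ₗ subsetsOfSize ∣ X ∣ n
∈-subsetsOfSize []            = Any.here refl
∈-subsetsOfSize (outside ∷ X) with ∣ X ∣ | ∈-subsetsOfSize X
... | zero  | X∈ = ∈-map⁺ (outside ∷_) X∈
... | suc _ | X∈ = ∈-++⁺ˡ (∈-map⁺ (outside ∷_) X∈)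
∈-subsetsOfSize (inside ∷ X) =
  ∈-++⁺ʳ (map (outside ∷_) (subsetsOfSize (suc ∣ X ∣) _)) (∈-map⁺ (inside ∷_) (∈-subsetsOfSize X))

-- The trade conditions with the quantifications over t-subsets restricted to the finite list
-- subsetsOfSize t v, which makes them decidable.
module _ {μ v : ℕ} (k t d m : ℕ) (B : Fin μ → List (Subset v)) where

  private
    _≟ₛ_ : (b c : Subset v) → Dec (b ≡ c)
    _≟ₛ_ = ≡-dec Bool._≟_
  open DecMembership _≟ₛ_ using (_∉?_)
  open DecUnique _≟ₛ_ using (unique?)

  Certificate : Set
  Certificate = t < k × k < v
    × (∀ i → Unique (B i))
    × (∀ i → length (B i) ≡ m)
    × (∀ i → All (λ b → ∣ b ∣ ≡ k) (B i))
    × (∀ i j → i ≢ j → All (_∉ₗ B j) (B i))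
    × All (λ X → (∀ i j → count X (B i) ≡ count X (B j)) × (∀ i → count X (B i) ≤ 1)) (subsetsOfSize t v)
    × (∀ x i → degree x (B i) ≡ d)

  certificate? : Dec Certificate
  certificate? = t <? k ×-dec k <? v
    ×-dec all? (λ i → unique? (B i))
    ×-dec all? (λ i → length (B i) ≟ m)
    ×-dec all? (λ i → All.all? (λ b → ∣ b ∣ ≟ k) (B i))
    ×-dec all? (λ i → all? (λ j → ¬? (i Fin.≟ j) →-dec All.all? (_∉? B j) (B i)))
    ×-dec All.all? (λ X → all? (λ i → all? (λ j → count X (B i) ≟ count X (B j)))
                           ×-dec all? (λ i → count X (B i) ≤? 1))
                   (subsetsOfSize t v)
    ×-dec all? (λ x → all? (λ i → degree x (B i) ≟ d))

  fromCertificate : Certificate → HomogeneousSteinerTrade μ v k t d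
  fromCertificate (t<k , k<v , unique , length≡m , sized , disjoint , onSubsets , regular) = record
    { trade = record
      { t<k       = t<k
      ; k<v       = k<v
      ; blocks    = B
      ; distinct  = unique
      ; volume    = length≡m
      ; blockSize = λ i b b∈ → All.lookup (sized i) b∈
      ; disjoint  = λ i j i≢j b b∈ → All.lookup (disjoint i j i≢j) b∈
      ; balanced  = λ X ∣X∣≡t → proj₁ (onSubsetOfSize X ∣X∣≡t)
      }
    ; steiner     = λ X ∣X∣≡t → proj₂ (onSubsetOfSize X ∣X∣≡t)
    ; homogeneous = regular
    }
    where
    onSubsetOfSize : ∀ X → ∣ X ∣ ≡ t →
      (∀ i j → count X (B i) ≡ count X (B j)) × (∀ i → count X (B i) ≤ 1)
    onSubsetOfSize X ∣X∣≡t =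
      All.lookup onSubsets (subst (λ s → X ∈ₗ subsetsOfSize s v) ∣X∣≡t (∈-subsetsOfSize X))

⟨_,_,_⟩ : ∀ {v} → ℕ → ℕ → ℕ → Subset v
⟨ a , b , c ⟩ = tabulate λ x → (toℕ x ≡ᵇ a) ∨ (toℕ x ≡ᵇ b) ∨ (toℕ x ≡ᵇ c)

select : ∀ {A : Set} → A → A → A → Fin 3 → A
select a b c zero             = a
select a b c (suc zero)       = b
select a b c (suc (suc zero)) = c

blocks12 : Fin 3 → List (Subset 12)
blocks12 = select
  ( ⟨ 0 , 1 , 2 ⟩ ∷ ⟨ 0 , 3 , 9 ⟩ ∷ ⟨ 0 , 5 , 7 ⟩ ∷ ⟨ 0 , 6 , 8 ⟩ ∷ ⟨ 0 , 10 , 11 ⟩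
    ∷ ⟨ 1 , 3 , 8 ⟩ ∷ ⟨ 1 , 4 , 6 ⟩ ∷ ⟨ 1 , 5 , 10 ⟩ ∷ ⟨ 1 , 7 , 11 ⟩ ∷ ⟨ 2 , 3 , 4 ⟩
    ∷ ⟨ 2 , 5 , 6 ⟩ ∷ ⟨ 2 , 7 , 8 ⟩ ∷ ⟨ 2 , 9 , 11 ⟩ ∷ ⟨ 3 , 5 , 11 ⟩ ∷ ⟨ 3 , 6 , 10 ⟩
    ∷ ⟨ 4 , 5 , 9 ⟩ ∷ ⟨ 4 , 7 , 10 ⟩ ∷ ⟨ 4 , 8 , 11 ⟩ ∷ ⟨ 6 , 7 , 9 ⟩ ∷ ⟨ 8 , 9 , 10 ⟩
    ∷ [] )
  ( ⟨ 0 , 1 , 5 ⟩ ∷ ⟨ 0 , 2 , 6 ⟩ ∷ ⟨ 0 , 3 , 11 ⟩ ∷ ⟨ 0 , 7 , 9 ⟩ ∷ ⟨ 0 , 8 , 10 ⟩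
    ∷ ⟨ 1 , 2 , 8 ⟩ ∷ ⟨ 1 , 3 , 4 ⟩ ∷ ⟨ 1 , 6 , 7 ⟩ ∷ ⟨ 1 , 10 , 11 ⟩ ∷ ⟨ 2 , 3 , 5 ⟩
    ∷ ⟨ 2 , 4 , 9 ⟩ ∷ ⟨ 2 , 7 , 11 ⟩ ∷ ⟨ 3 , 6 , 8 ⟩ ∷ ⟨ 3 , 9 , 10 ⟩ ∷ ⟨ 4 , 5 , 11 ⟩
    ∷ ⟨ 4 , 6 , 10 ⟩ ∷ ⟨ 4 , 7 , 8 ⟩ ∷ ⟨ 5 , 6 , 9 ⟩ ∷ ⟨ 5 , 7 , 10 ⟩ ∷ ⟨ 8 , 9 , 11 ⟩
    ∷ [] )
  ( ⟨ 0 , 1 , 7 ⟩ ∷ ⟨ 0 , 2 , 3 ⟩ ∷ ⟨ 0 , 5 , 9 ⟩ ∷ ⟨ 0 , 6 , 10 ⟩ ∷ ⟨ 0 , 8 , 11 ⟩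
    ∷ ⟨ 1 , 2 , 5 ⟩ ∷ ⟨ 1 , 3 , 11 ⟩ ∷ ⟨ 1 , 4 , 10 ⟩ ∷ ⟨ 1 , 6 , 8 ⟩ ∷ ⟨ 2 , 4 , 11 ⟩
    ∷ ⟨ 2 , 6 , 7 ⟩ ∷ ⟨ 2 , 8 , 9 ⟩ ∷ ⟨ 3 , 4 , 8 ⟩ ∷ ⟨ 3 , 5 , 10 ⟩ ∷ ⟨ 3 , 6 , 9 ⟩
    ∷ ⟨ 4 , 5 , 6 ⟩ ∷ ⟨ 4 , 7 , 9 ⟩ ∷ ⟨ 5 , 7 , 11 ⟩ ∷ ⟨ 7 , 8 , 10 ⟩ ∷ ⟨ 9 , 10 , 11 ⟩
    ∷ [] )

trade12 : HomogeneousSteinerTrade 3 12 3 2 5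
trade12 = fromCertificate 3 2 5 20 blocks12 (toWitness {a? = certificate? 3 2 5 20 blocks12} _)

blocks15 : Fin 3 → List (Subset 15)
blocks15 = select
  ( ⟨ 0 , 1 , 7 ⟩ ∷ ⟨ 0 , 2 , 14 ⟩ ∷ ⟨ 0 , 3 , 11 ⟩ ∷ ⟨ 0 , 4 , 6 ⟩ ∷ ⟨ 0 , 8 , 10 ⟩
    ∷ ⟨ 1 , 2 , 4 ⟩ ∷ ⟨ 1 , 5 , 8 ⟩ ∷ ⟨ 1 , 6 , 10 ⟩ ∷ ⟨ 1 , 9 , 14 ⟩ ∷ ⟨ 2 , 3 , 8 ⟩
    ∷ ⟨ 2 , 5 , 12 ⟩ ∷ ⟨ 2 , 7 , 9 ⟩ ∷ ⟨ 3 , 6 , 13 ⟩ ∷ ⟨ 3 , 7 , 10 ⟩ ∷ ⟨ 3 , 9 , 12 ⟩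
    ∷ ⟨ 4 , 5 , 13 ⟩ ∷ ⟨ 4 , 9 , 11 ⟩ ∷ ⟨ 4 , 12 , 14 ⟩ ∷ ⟨ 5 , 7 , 14 ⟩ ∷ ⟨ 5 , 10 , 11 ⟩
    ∷ ⟨ 6 , 8 , 9 ⟩ ∷ ⟨ 6 , 11 , 12 ⟩ ∷ ⟨ 7 , 11 , 13 ⟩ ∷ ⟨ 8 , 13 , 14 ⟩ ∷ ⟨ 10 , 12 , 13 ⟩
    ∷ [] )
  ( ⟨ 0 , 1 , 14 ⟩ ∷ ⟨ 0 , 2 , 8 ⟩ ∷ ⟨ 0 , 3 , 7 ⟩ ∷ ⟨ 0 , 4 , 11 ⟩ ∷ ⟨ 0 , 6 , 10 ⟩
    ∷ ⟨ 1 , 2 , 5 ⟩ ∷ ⟨ 1 , 4 , 9 ⟩ ∷ ⟨ 1 , 6 , 8 ⟩ ∷ ⟨ 1 , 7 , 10 ⟩ ∷ ⟨ 2 , 3 , 9 ⟩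
    ∷ ⟨ 2 , 4 , 12 ⟩ ∷ ⟨ 2 , 7 , 14 ⟩ ∷ ⟨ 3 , 6 , 11 ⟩ ∷ ⟨ 3 , 8 , 13 ⟩ ∷ ⟨ 3 , 10 , 12 ⟩
    ∷ ⟨ 4 , 5 , 14 ⟩ ∷ ⟨ 4 , 6 , 13 ⟩ ∷ ⟨ 5 , 7 , 13 ⟩ ∷ ⟨ 5 , 8 , 10 ⟩ ∷ ⟨ 5 , 11 , 12 ⟩
    ∷ ⟨ 6 , 9 , 12 ⟩ ∷ ⟨ 7 , 9 , 11 ⟩ ∷ ⟨ 8 , 9 , 14 ⟩ ∷ ⟨ 10 , 11 , 13 ⟩ ∷ ⟨ 12 , 13 , 14 ⟩
    ∷ [] )
  ( ⟨ 0 , 1 , 6 ⟩ ∷ ⟨ 0 , 2 , 4 ⟩ ∷ ⟨ 0 , 3 , 10 ⟩ ∷ ⟨ 0 , 7 , 11 ⟩ ∷ ⟨ 0 , 8 , 14 ⟩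
    ∷ ⟨ 1 , 2 , 9 ⟩ ∷ ⟨ 1 , 4 , 14 ⟩ ∷ ⟨ 1 , 5 , 7 ⟩ ∷ ⟨ 1 , 8 , 10 ⟩ ∷ ⟨ 2 , 3 , 7 ⟩
    ∷ ⟨ 2 , 5 , 8 ⟩ ∷ ⟨ 2 , 12 , 14 ⟩ ∷ ⟨ 3 , 6 , 12 ⟩ ∷ ⟨ 3 , 8 , 9 ⟩ ∷ ⟨ 3 , 11 , 13 ⟩
    ∷ ⟨ 4 , 5 , 11 ⟩ ∷ ⟨ 4 , 6 , 9 ⟩ ∷ ⟨ 4 , 12 , 13 ⟩ ∷ ⟨ 5 , 10 , 12 ⟩ ∷ ⟨ 5 , 13 , 14 ⟩
    ∷ ⟨ 6 , 8 , 13 ⟩ ∷ ⟨ 6 , 10 , 11 ⟩ ∷ ⟨ 7 , 9 , 14 ⟩ ∷ ⟨ 7 , 10 , 13 ⟩ ∷ ⟨ 9 , 11 , 12 ⟩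
    ∷ [] )

trade15 : HomogeneousSteinerTrade 3 15 3 2 5
trade15 = fromCertificate 3 2 5 25 blocks15 (toWitness {a? = certificate? 3 2 5 25 blocks15} _)

blocks21 : Fin 3 → List (Subset 21)
blocks21 = select
  ( ⟨ 0 , 1 , 15 ⟩ ∷ ⟨ 0 , 6 , 14 ⟩ ∷ ⟨ 0 , 9 , 12 ⟩ ∷ ⟨ 0 , 10 , 16 ⟩ ∷ ⟨ 0 , 11 , 20 ⟩
    ∷ ⟨ 1 , 2 , 16 ⟩ ∷ ⟨ 1 , 10 , 13 ⟩ ∷ ⟨ 1 , 11 , 17 ⟩ ∷ ⟨ 1 , 12 , 14 ⟩ ∷ ⟨ 2 , 3 , 17 ⟩
    ∷ ⟨ 2 , 7 , 11 ⟩ ∷ ⟨ 2 , 12 , 18 ⟩ ∷ ⟨ 2 , 13 , 15 ⟩ ∷ ⟨ 3 , 4 , 18 ⟩ ∷ ⟨ 3 , 7 , 16 ⟩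
    ∷ ⟨ 3 , 8 , 12 ⟩ ∷ ⟨ 3 , 13 , 19 ⟩ ∷ ⟨ 4 , 5 , 19 ⟩ ∷ ⟨ 4 , 7 , 20 ⟩ ∷ ⟨ 4 , 8 , 17 ⟩
    ∷ ⟨ 4 , 9 , 13 ⟩ ∷ ⟨ 5 , 6 , 20 ⟩ ∷ ⟨ 5 , 7 , 10 ⟩ ∷ ⟨ 5 , 8 , 14 ⟩ ∷ ⟨ 5 , 9 , 18 ⟩
    ∷ ⟨ 6 , 8 , 11 ⟩ ∷ ⟨ 6 , 9 , 15 ⟩ ∷ ⟨ 6 , 10 , 19 ⟩ ∷ ⟨ 7 , 17 , 19 ⟩ ∷ ⟨ 8 , 18 , 20 ⟩
    ∷ ⟨ 9 , 14 , 19 ⟩ ∷ ⟨ 10 , 15 , 20 ⟩ ∷ ⟨ 11 , 14 , 16 ⟩ ∷ ⟨ 12 , 15 , 17 ⟩ ∷ ⟨ 13 , 16 , 18 ⟩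
    ∷ [] )
  ( ⟨ 0 , 1 , 10 ⟩ ∷ ⟨ 0 , 6 , 9 ⟩ ∷ ⟨ 0 , 11 , 16 ⟩ ∷ ⟨ 0 , 12 , 14 ⟩ ∷ ⟨ 0 , 15 , 20 ⟩
    ∷ ⟨ 1 , 2 , 11 ⟩ ∷ ⟨ 1 , 12 , 17 ⟩ ∷ ⟨ 1 , 13 , 15 ⟩ ∷ ⟨ 1 , 14 , 16 ⟩ ∷ ⟨ 2 , 3 , 12 ⟩
    ∷ ⟨ 2 , 7 , 16 ⟩ ∷ ⟨ 2 , 13 , 18 ⟩ ∷ ⟨ 2 , 15 , 17 ⟩ ∷ ⟨ 3 , 4 , 13 ⟩ ∷ ⟨ 3 , 7 , 19 ⟩
    ∷ ⟨ 3 , 8 , 17 ⟩ ∷ ⟨ 3 , 16 , 18 ⟩ ∷ ⟨ 4 , 5 , 7 ⟩ ∷ ⟨ 4 , 8 , 20 ⟩ ∷ ⟨ 4 , 9 , 18 ⟩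
    ∷ ⟨ 4 , 17 , 19 ⟩ ∷ ⟨ 5 , 6 , 8 ⟩ ∷ ⟨ 5 , 9 , 14 ⟩ ∷ ⟨ 5 , 10 , 19 ⟩ ∷ ⟨ 5 , 18 , 20 ⟩
    ∷ ⟨ 6 , 10 , 15 ⟩ ∷ ⟨ 6 , 11 , 20 ⟩ ∷ ⟨ 6 , 14 , 19 ⟩ ∷ ⟨ 7 , 10 , 20 ⟩ ∷ ⟨ 7 , 11 , 17 ⟩
    ∷ ⟨ 8 , 11 , 14 ⟩ ∷ ⟨ 8 , 12 , 18 ⟩ ∷ ⟨ 9 , 12 , 15 ⟩ ∷ ⟨ 9 , 13 , 19 ⟩ ∷ ⟨ 10 , 13 , 16 ⟩
    ∷ [] )
  ( ⟨ 0 , 1 , 12 ⟩ ∷ ⟨ 0 , 6 , 11 ⟩ ∷ ⟨ 0 , 9 , 15 ⟩ ∷ ⟨ 0 , 10 , 20 ⟩ ∷ ⟨ 0 , 14 , 16 ⟩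
    ∷ ⟨ 1 , 2 , 13 ⟩ ∷ ⟨ 1 , 10 , 16 ⟩ ∷ ⟨ 1 , 11 , 14 ⟩ ∷ ⟨ 1 , 15 , 17 ⟩ ∷ ⟨ 2 , 3 , 7 ⟩
    ∷ ⟨ 2 , 11 , 17 ⟩ ∷ ⟨ 2 , 12 , 15 ⟩ ∷ ⟨ 2 , 16 , 18 ⟩ ∷ ⟨ 3 , 4 , 8 ⟩ ∷ ⟨ 3 , 12 , 18 ⟩
    ∷ ⟨ 3 , 13 , 16 ⟩ ∷ ⟨ 3 , 17 , 19 ⟩ ∷ ⟨ 4 , 5 , 9 ⟩ ∷ ⟨ 4 , 7 , 17 ⟩ ∷ ⟨ 4 , 13 , 19 ⟩
    ∷ ⟨ 4 , 18 , 20 ⟩ ∷ ⟨ 5 , 6 , 10 ⟩ ∷ ⟨ 5 , 7 , 20 ⟩ ∷ ⟨ 5 , 8 , 18 ⟩ ∷ ⟨ 5 , 14 , 19 ⟩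
    ∷ ⟨ 6 , 8 , 14 ⟩ ∷ ⟨ 6 , 9 , 19 ⟩ ∷ ⟨ 6 , 15 , 20 ⟩ ∷ ⟨ 7 , 10 , 19 ⟩ ∷ ⟨ 7 , 11 , 16 ⟩
    ∷ ⟨ 8 , 11 , 20 ⟩ ∷ ⟨ 8 , 12 , 17 ⟩ ∷ ⟨ 9 , 12 , 14 ⟩ ∷ ⟨ 9 , 13 , 18 ⟩ ∷ ⟨ 10 , 13 , 15 ⟩
    ∷ [] )

trade21 : HomogeneousSteinerTrade 3 21 3 2 5
trade21 = fromCertificate 3 2 5 35 blocks21 (toWitness {a? = certificate? 3 2 5 35 blocks21} _)

-- Apart from the three small orders, each admissible order is 12 plus a smaller admissible order;
-- the exception is 30, since 18 is not admissible.
construction : ∀ n → n ≢ 2 → HomogeneousSteinerTrade 3 ((4 + n) * 3) 3 2 5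
construction 0 _   = trade12
construction 1 _   = trade15
construction 2 2≢2 = contradiction refl 2≢2
construction 3 _   = trade21
construction (suc (suc (suc (suc n)))) _ with n ≟ 2
... | yes refl = trade15 ⊕ trade15
... | no n≢2   = trade12 ⊕ construction n n≢2

sufficient : ∀ {v} → 12 ≤ v → 3 ∣ v → v ≢ 18 → HomogeneousSteinerTrade 3 v 3 2 5
sufficient 12≤v (divides q refl) v≢18 with m≤n⇒∃[o]m+o≡n (*-cancelʳ-≤ 4 q 3 12≤v)
... | n , refl = construction n λ { refl → v≢18 refl }

theorem3p4 : ∀ (v : ℕ) → v ≢ 18 →
    (∃ λ m → Σ (Trade 3 v 3 2 m) λ T → Steiner T × Homogeneous 5 T)
      ⇔ (12 ≤ v × v % 3 ≡ 0)
theorem3p4 v v≢18 = mk⇔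
  (λ (_ , T , S , H) → let 12≤v , 3∣v = necessary T S H in 12≤v , n∣m⇒m%n≡0 v 3 3∣v)
  (λ (12≤v , v%3≡0) → let H = sufficient 12≤v (m%n≡0⇒n∣m v 3 v%3≡0) v≢18 in
    _ , trade H , fullySteiner⇒steiner (trade H) (steiner H) , homogeneous H)
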